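{- Let $k\geq 2$ be an integer, let $p$ be a positive integer, and let $S_k$ be the star with $k$ vertices. Then: (1) if $n\leq k-2$ then $t_p(n,S_k)=n(n-1)^p$; (2) if $n>k-2$ and $nk$ is even then $t_p(n,S_k)=n(k-2)^p$; (3) if $n>k-2$ and $nk$ is odd then $t_p(n,S_k)=(n-1)(k-2)^p+(k-3)^p$.
   Context: All graphs are finite, simple, undirected. For a graph $G$ with degree sequence $d_1,\ldots,d_n$, $e_p(G)=\sum_{i=1}^n d_i^p$. For a fixed graph $H$, $t_p(n,H)$ is the maximum of $e_p(G)$ over all $n$-vertex graphs not containing $H$ as a subgraph. The star $S_k$ is $K_{1,k-1}$ (one center adjacent to $k-1$ leaves). -}

module Defs where

open import Data.Nat using (ℕ; _^_; _<_)
open import Data.Bool using (Bool; true; false; if_then_else_)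
open import Data.Fin using (Fin; zero; suc)
open import Data.List using (List; map; allFin)
open import Data.Nat.ListAction using (sum)
open import Data.Product using (Σ; _×_)
open import Function.Definitions using (Injective)
open import Relation.Binary.PropositionalEquality using (_≡_)
open import Relation.Nullary using (¬_)

record Graph (n : ℕ) : Set where
  field
    adj    : Fin n → Fin n → Bool
    sym    : ∀ u v → adj u v ≡ adj v u
    irrefl : ∀ u → adj u u ≡ false
open Graph public

degree : ∀ {n} → Graph n → Fin n → ℕ
degree {n} G i = sum (map (λ j → if adj G i j then 1 else 0) (allFin n))

e : ∀ {n} → ℕ → Graph n → ℕ
e {n} p G = sum (map (λ i → degree G i ^ p) (allFin n))

ContainsSubgraph : ∀ {m n} → Graph n → Graph m → Set
ContainsSubgraph {m} {n} G H =
  Σ (Fin m → Fin n) λ f → Injective _≡_ _≡_ f ×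
    (∀ u v → adj H u v ≡ true → adj G (f u) (f v) ≡ true)

starAdj : ∀ {k} → Fin k → Fin k → Bool
starAdj zero    zero    = false
starAdj zero    (suc _) = true
starAdj (suc _) zero    = true
starAdj (suc _) (suc _) = false

starSym : ∀ {k} (u v : Fin k) → starAdj u v ≡ starAdj v u
starSym zero    zero    = _≡_.refl
starSym zero    (suc _) = _≡_.refl
starSym (suc _) zero    = _≡_.refl
starSym (suc _) (suc _) = _≡_.refl

starIrrefl : ∀ {k} (u : Fin k) → starAdj u u ≡ false
starIrrefl zero    = _≡_.refl
starIrrefl (suc _) = _≡_.refl

Star : (k : ℕ) → Graph k
Star k = record { adj = starAdj ; sym = starSym ; irrefl = starIrrefl }

-- "t_p(n,H) = t": t is the maximum of e_p(G) over all n-vertex H-free graphs G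
-- (it is attained by some H-free graph and bounds all of them).
IsTp : ∀ {m} → ℕ → (n : ℕ) → Graph m → ℕ → Set
IsTp p n H t =
  (Σ (Graph n) λ G → ¬ ContainsSubgraph G H × e p G ≡ t)
  × (∀ (G : Graph n) → ¬ ContainsSubgraph G H → e p G Data.Nat.≤ t)

-- A star S_k lies in G exactly when some vertex has k − 1 neighbours (pick them injectively
-- from its neighbourhood), so the S_k-free graphs are those of maximum degree at most k − 2,
-- and then e_p(G) ≤ n Δ^p with Δ = min(n − 1, k − 2). If nk is odd, a (k − 2)-regular graph
-- would have odd degree sum, contradicting the handshake lemma, so some vertex has degree at
-- most k − 3. The bounds are attained by circulants on ℤ/n: joining vertices at cyclic
-- distance at most r gives a 2r-regular graph, and adding the matching {x, x + h} (x < h) on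
-- the first 2h vertices raises those degrees by one.

module Submission where

open import Data.Bool using (Bool; true; false; if_then_else_; T; _∧_; _∨_)
open import Data.Bool.Properties using (T-∧; T-∨)
open import Data.Empty using (⊥; ⊥-elim)
open import Data.Fin using (Fin; zero; suc; toℕ; fromℕ; punchIn; punchOut)
open import Data.Fin.Properties
  using (¬Fin0; toℕ<n; toℕ-fromℕ; toℕ-injective; any?; ¬∀⟶∃¬; punchIn-injective; punchInᵢ≢i;
         punchOut-injective; punchIn-punchOut)
  renaming (_≟_ to _≟ᶠ_; suc-injective to suc-injectiveᶠ)
open import Data.List using (map; allFin; tabulate)
open import Data.List.Properties using (map-tabulate)
open import Data.Nat
open import Data.Nat.Divisibility
  using (_∣_; divides; ∣-refl; ∣m∣n⇒∣m+n; ∣m+n∣m⇒∣n; ∣1⇒≡1; n∣m*n; ∣m⇒∣m*n; ∣n⇒∣m*n)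
open import Data.Nat.ListAction using (sum)
open import Data.Nat.Primality using (prime[2]; euclidsLemma)
open import Data.Nat.Properties
open import Data.Nat.Solver using (module +-*-Solver)
open import Data.Product using (Σ; ∃; _×_; _,_; proj₂)
open import Data.Sum using (inj₁; inj₂; [_,_])
open import Function using (_∘_; id)
open import Function.Bundles using (Equivalence)
open import Function.Definitions using (Injective)
open import Relation.Binary.PropositionalEquality
  using (_≡_; _≢_; refl; sym; trans; cong; cong₂; subst; module ≡-Reasoning)
open import Relation.Nullary using (¬_; yes; no)
open import Algebra.Properties.CommutativeMonoid.Sum +-0-commutativeMonoid
  using (sum-syntax; sum-cong-≗; ∑-distrib-+; sum-remove; sum-replicate-zero)

open import Defs renaming (sym to adj-sym)

m∸[m+n∸o]≡o∸n : ∀ m n o → o ≤ m + n → m ∸ (m + n ∸ o) ≡ o ∸ n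
m∸[m+n∸o]≡o∸n m zero    o       o≤m   rewrite +-identityʳ m = m∸[m∸n]≡n o≤m
m∸[m+n∸o]≡o∸n m (suc n) zero    _     = m≤n⇒m∸n≡0 (m≤m+n m (suc n))
m∸[m+n∸o]≡o∸n m (suc n) (suc o) o<m+n rewrite +-suc m n = m∸[m+n∸o]≡o∸n m n o (s≤s⁻¹ o<m+n)

half-< : ∀ {m n} → m + m < n + n → m < n
half-< {m} {n} 2m<2n with m <? n
... | yes m<n = m<n
... | no  m≮n = ⊥-elim (<⇒≱ 2m<2n (+-mono-≤ (≮⇒≥ m≮n) (≮⇒≥ m≮n)))

+-regroup : ∀ a b c d e → (a + b) + ((c + d) + e) ≡ (a + d) + (b + c) + e
+-regroup = solve 5 (λ a b c d e → (a :+ b) :+ ((c :+ d) :+ e) := (a :+ d) :+ (b :+ c) :+ e) refl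
  where open +-*-Solver

data EvenOrOdd : ℕ → Set where
  even : ∀ q → EvenOrOdd (q + q)
  odd  : ∀ q → EvenOrOdd (suc (q + q))

even-or-odd : ∀ n → EvenOrOdd n
even-or-odd zero = even 0
even-or-odd (suc n) with even-or-odd n
... | even q = odd q
... | odd  q = subst EvenOrOdd (cong suc (+-suc q q)) (even (suc q))

2∣m+m : ∀ m → 2 ∣ m + m
2∣m+m m = divides m (trans (cong (m +_) (sym (+-identityʳ m))) (*-comm 2 m))

¬2∣odd : ∀ q → ¬ 2 ∣ suc (q + q)
¬2∣odd q 2∣odd with ∣1⇒≡1 (∣m+n∣m⇒∣n (subst (2 ∣_) (+-comm 1 (q + q)) 2∣odd) (2∣m+m q))
... | ()

2∣n*[n∸1] : ∀ n → 2 ∣ n * (n ∸ 1)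
2∣n*[n∸1] n with even-or-odd n
... | even q = ∣m⇒∣m*n _ (2∣m+m q)
... | odd  q = ∣n⇒∣m*n (suc (q + q)) (2∣m+m q)

2∣n*[2+d]⇒2∣n*d : ∀ n d → 2 ∣ n * (2 + d) → 2 ∣ n * d
2∣n*[2+d]⇒2∣n*d n d 2∣ = ∣m+n∣m⇒∣n (subst (2 ∣_) (*-distribˡ-+ n 2 d) 2∣) (n∣m*n n)

2∣n*d⇒2∣n*[2+d] : ∀ n d → 2 ∣ n * d → 2 ∣ n * (2 + d)
2∣n*d⇒2∣n*[2+d] n d 2∣ = subst (2 ∣_) (sym (*-distribˡ-+ n 2 d)) (∣m∣n⇒∣m+n (n∣m*n n) 2∣)

-- Written with if_then_else_ so that degree G i unfolds to a sum of ⟦ adj G i j ⟧.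
⟦_⟧ : Bool → ℕ
⟦ b ⟧ = if b then 1 else 0

⟦⟧≤1 : ∀ b → ⟦ b ⟧ ≤ 1
⟦⟧≤1 true  = ≤-refl
⟦⟧≤1 false = z≤n

⟦⟧-true : ∀ {b} → T b → ⟦ b ⟧ ≡ 1
⟦⟧-true {true} _ = refl

⟦⟧-false : ∀ {b} → ¬ T b → ⟦ b ⟧ ≡ 0
⟦⟧-false {true}  ¬b = ⊥-elim (¬b _)
⟦⟧-false {false} _  = refl

⟦∨⟧ : ∀ a b → (T a → T b → ⊥) → ⟦ a ∨ b ⟧ ≡ ⟦ a ⟧ + ⟦ b ⟧
⟦∨⟧ true  true  disjoint = ⊥-elim (disjoint _ _)
⟦∨⟧ true  false _        = refl
⟦∨⟧ false b     _        = refl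

sum-tabulate : ∀ {n} (f : Fin n → ℕ) → sum (tabulate f) ≡ ∑[ i < n ] f i
sum-tabulate {zero}  f = refl
sum-tabulate {suc n} f = cong (f zero +_) (sum-tabulate (f ∘ suc))

sum-map-allFin : ∀ {n} (f : Fin n → ℕ) → sum (map f (allFin n)) ≡ ∑[ i < n ] f i
sum-map-allFin f = trans (cong sum (map-tabulate id f)) (sum-tabulate f)

∑-const : ∀ n c → ∑[ i < n ] c ≡ n * c
∑-const zero    c = refl
∑-const (suc n) c = cong (c +_) (∑-const n c)

∑-≤ : ∀ {n} (f : Fin n → ℕ) {c} → (∀ i → f i ≤ c) → ∑[ i < n ] f i ≤ n * c
∑-≤ {zero}  f f≤c = z≤n
∑-≤ {suc n} f f≤c = +-mono-≤ (f≤c zero) (∑-≤ (f ∘ suc) (f≤c ∘ suc))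

∑-≤-except : ∀ {n} (f : Fin n → ℕ) (i : Fin n) {b c} → f i ≤ b → (∀ j → f j ≤ c) →
             ∑[ j < n ] f j ≤ (n ∸ 1) * c + b
∑-≤-except {suc n} f i {b} {c} fi≤b f≤c = begin
  ∑[ j < suc n ] f j                  ≡⟨ sum-remove {i = i} f ⟩
  f i + ∑[ j < n ] f (punchIn i j)    ≤⟨ +-mono-≤ fi≤b (∑-≤ (f ∘ punchIn i) (f≤c ∘ punchIn i)) ⟩
  b + n * c                           ≡⟨ +-comm b (n * c) ⟩
  n * c + b                           ∎
  where open ≤-Reasoning

count : ∀ {n} → (Fin n → Bool) → ℕ
count {n} P = ∑[ j < n ] ⟦ P j ⟧

Embedding : ∀ {n} → ℕ → (Fin n → Bool) → Set
Embedding {n} m P = Σ (Fin m → Fin n) λ g → Injective _≡_ _≡_ g × (∀ j → P (g j) ≡ true)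

embedding-suc : ∀ {m n} {P : Fin (suc n) → Bool} → Embedding m (P ∘ suc) → Embedding m P
embedding-suc (g , g-inj , g∈P) = suc ∘ g , g-inj ∘ suc-injectiveᶠ , g∈P

embedding-cons : ∀ {m n} {P : Fin (suc n) → Bool} → P zero ≡ true → Embedding m (P ∘ suc) →
                 Embedding (suc m) P
embedding-cons {m} {n} {P} P0 (g , g-inj , g∈P) = g′ , g′-inj , g′∈P
  where
  g′ : Fin (suc m) → Fin (suc n)
  g′ zero    = zero
  g′ (suc j) = suc (g j)
  g′-inj : Injective _≡_ _≡_ g′
  g′-inj {zero}  {zero}  _  = refl
  g′-inj {suc i} {suc j} eq = cong suc (g-inj (suc-injectiveᶠ eq))
  g′∈P : ∀ j → P (g′ j) ≡ true
  g′∈P zero    = P0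
  g′∈P (suc j) = g∈P j

embedding-pred : ∀ {m n} {P : Fin (suc n) → Bool} ((g , _ , _) : Embedding m P) →
                 (∀ j → zero ≢ g j) → Embedding m (P ∘ suc)
embedding-pred {P = P} (g , g-inj , g∈P) 0∉g =
  (λ j → punchOut (0∉g j)) ,
  (λ eq → g-inj (punchOut-injective (0∉g _) (0∉g _) eq)) ,
  (λ j → trans (cong P (punchIn-punchOut (0∉g j))) (g∈P j))

embedding⇒≤count : ∀ {m n} {P : Fin n → Bool} → Embedding m P → m ≤ count P
embedding⇒≤count {zero}  _ = z≤n
embedding⇒≤count {suc m} {zero} (g , _) with g zero
... | ()
embedding⇒≤count {suc m} {suc n} {P} e@(g , g-inj , g∈P) with any? (λ j → zero ≟ᶠ g j)
... | no 0∉g = ≤-trans (embedding⇒≤count (embedding-pred {P = P} e λ j 0≡gj → 0∉g (j , 0≡gj))) (m≤n+m _ _)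
... | yes (j₀ , 0≡gj₀) rewrite trans (cong P 0≡gj₀) (g∈P j₀) =
  s≤s (embedding⇒≤count (embedding-pred {P = P} (g ∘ punchIn j₀ , g-inj′ , g∈P ∘ punchIn j₀) 0∉g′))
  where
  g-inj′ : Injective _≡_ _≡_ (g ∘ punchIn j₀)
  g-inj′ eq = punchIn-injective j₀ _ _ (g-inj eq)
  0∉g′ : ∀ t → zero ≢ g (punchIn j₀ t)
  0∉g′ t 0≡g = punchInᵢ≢i j₀ t (g-inj (trans (sym 0≡g) 0≡gj₀))

≤count⇒embedding : ∀ {m n} (P : Fin n → Bool) → m ≤ count P → Embedding m P
≤count⇒embedding {zero}          P _   = (λ ()) , (λ {i} → ⊥-elim (¬Fin0 i)) , λ ()
≤count⇒embedding {suc m} {suc n} P m<c with P zero in P0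
... | true  = embedding-cons {P = P} P0 (≤count⇒embedding (P ∘ suc) (s≤s⁻¹ m<c))
... | false = embedding-suc {P = P} (≤count⇒embedding (P ∘ suc) m<c)

-- Stars, degrees and e_p

degree≡count : ∀ {n} (G : Graph n) i → degree G i ≡ count (adj G i)
degree≡count G i = sum-map-allFin (λ j → ⟦ adj G i j ⟧)

degree≤n∸1 : ∀ {n} (G : Graph n) i → degree G i ≤ n ∸ 1
degree≤n∸1 {n} G i = begin
  degree G i              ≡⟨ degree≡count G i ⟩
  count (adj G i)         ≤⟨ ∑-≤-except _ i (≤-reflexive (cong ⟦_⟧ (irrefl G i))) (λ j → ⟦⟧≤1 (adj G i j)) ⟩
  (n ∸ 1) * 1 + 0         ≡⟨ trans (+-identityʳ _) (*-identityʳ _) ⟩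
  n ∸ 1                   ∎
  where open ≤-Reasoning

star⇒embedding : ∀ {n d} {G : Graph n} ((f , _ , _) : ContainsSubgraph G (Star (suc (suc d)))) →
                   Embedding (suc d) (adj G (f zero))
star⇒embedding (f , f-inj , f-edge) = f ∘ suc , suc-injectiveᶠ ∘ f-inj , λ j → f-edge zero (suc j) refl

embedding⇒star : ∀ {n d} (G : Graph n) i → Embedding (suc d) (adj G i) →
                 ContainsSubgraph G (Star (suc (suc d)))
embedding⇒star {d = d} G i (g , g-inj , g∈N) = f , f-inj , f-edge
  where
  i≢g : ∀ j → i ≢ g j
  i≢g j i≡gj with trans (sym (irrefl G i)) (trans (cong (adj G i) i≡gj) (g∈N j))
  ... | ()
  f : Fin (suc (suc d)) → Fin _
  f zero    = i
  f (suc j) = g j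
  f-inj : Injective _≡_ _≡_ f
  f-inj {zero}  {zero}  _  = refl
  f-inj {zero}  {suc y} eq = ⊥-elim (i≢g y eq)
  f-inj {suc x} {zero}  eq = ⊥-elim (i≢g x (sym eq))
  f-inj {suc x} {suc y} eq = cong suc (g-inj eq)
  f-edge : ∀ u v → adj (Star (suc (suc d))) u v ≡ true → adj G (f u) (f v) ≡ true
  f-edge zero    (suc v) _ = g∈N v
  f-edge (suc u) zero    _ = trans (adj-sym G (g u) i) (g∈N u)

degree≤⇒starFree : ∀ {n d} (G : Graph n) → (∀ i → degree G i ≤ d) →
                   ¬ ContainsSubgraph G (Star (suc (suc d)))
degree≤⇒starFree G Δ≤d star@(f , _) =
  <⇒≱ (subst (_ <_) (sym (degree≡count G (f zero))) (embedding⇒≤count (star⇒embedding {G = G} star)))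
      (Δ≤d (f zero))

starFree⇒degree≤ : ∀ {n d} (G : Graph n) → ¬ ContainsSubgraph G (Star (suc (suc d))) →
                   ∀ i → degree G i ≤ d
starFree⇒degree≤ {d = d} G free i with degree G i ≤? d
... | yes deg≤d = deg≤d
... | no  deg≰d = ⊥-elim (free (embedding⇒star {d = d} G i (≤count⇒embedding (adj G i) d<count)))
  where
  d<count : d < count (adj G i)
  d<count = subst (d <_) (degree≡count G i) (≰⇒> deg≰d)

handshake : ∀ {n} (a : Fin n → Fin n → Bool) → (∀ u v → a u v ≡ a v u) → (∀ u → a u u ≡ false) →
            2 ∣ ∑[ i < n ] ∑[ j < n ] ⟦ a i j ⟧
handshake {zero}  a a-sym a-irr = divides 0 refl
handshake {suc n} a a-sym a-irr =
  subst (2 ∣_) (sym split)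
        (∣m∣n⇒∣m+n (2∣m+m R) (handshake inner (λ u v → a-sym (suc u) (suc v)) (a-irr ∘ suc)))
  where
  inner : Fin n → Fin n → Bool
  inner i j = a (suc i) (suc j)
  R I : ℕ
  R = ∑[ j < n ] ⟦ a zero (suc j) ⟧
  I = ∑[ i < n ] ∑[ j < n ] ⟦ inner i j ⟧
  split : ∑[ i < suc n ] ∑[ j < suc n ] ⟦ a i j ⟧ ≡ R + R + I
  split = begin
    ⟦ a zero zero ⟧ + R + ∑[ i < n ] (⟦ a (suc i) zero ⟧ + ∑[ j < n ] ⟦ inner i j ⟧)
      ≡⟨ cong₂ _+_ (cong (λ b → ⟦ b ⟧ + R) (a-irr zero))
                   (∑-distrib-+ (λ i → ⟦ a (suc i) zero ⟧) (λ i → ∑[ j < n ] ⟦ inner i j ⟧)) ⟩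
    R + (∑[ i < n ] ⟦ a (suc i) zero ⟧ + I)
      ≡⟨ cong (λ c → R + (c + I)) (sum-cong-≗ (λ i → cong ⟦_⟧ (a-sym (suc i) zero))) ⟩
    R + (R + I)
      ≡⟨ +-assoc R R I ⟨
    R + R + I ∎
    where open ≡-Reasoning

handshake-degrees : ∀ {n} (G : Graph n) → 2 ∣ ∑[ i < n ] degree G i
handshake-degrees G =
  subst (2 ∣_) (sym (sum-cong-≗ (degree≡count G))) (handshake (adj G) (adj-sym G) (irrefl G))

e≡∑ : ∀ {n} p (G : Graph n) → e p G ≡ ∑[ i < n ] (degree G i ^ p)
e≡∑ p G = sum-map-allFin (λ i → degree G i ^ p)

e-regular : ∀ {n d} p (G : Graph n) → (∀ i → degree G i ≡ d) → e p G ≡ n * d ^ p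
e-regular {n} {d} p G reg =
  trans (e≡∑ p G) (trans (sum-cong-≗ (λ i → cong (_^ p) (reg i))) (∑-const n (d ^ p)))

e-≤ : ∀ {n d} p (G : Graph n) → (∀ i → degree G i ≤ d) → e p G ≤ n * d ^ p
e-≤ p G Δ≤d = subst (_≤ _) (sym (e≡∑ p G)) (∑-≤ _ (λ i → ^-monoˡ-≤ p (Δ≤d i)))

e-except : ∀ {n d d′} p (G : Graph n) i₀ → degree G i₀ ≡ d′ → (∀ i → i ≢ i₀ → degree G i ≡ d) →
           e p G ≡ (n ∸ 1) * d ^ p + d′ ^ p
e-except {suc n} {d} {d′} p G i₀ deg-i₀ deg-others = begin
  e p G                                         ≡⟨ e≡∑ p G ⟩
  ∑[ i < suc n ] (degree G i ^ p)                ≡⟨ sum-remove {i = i₀} (λ i → degree G i ^ p) ⟩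
  degree G i₀ ^ p + ∑[ j < n ] (degree G (punchIn i₀ j) ^ p)
    ≡⟨ cong₂ _+_ (cong (_^ p) deg-i₀) (sum-cong-≗ λ j → cong (_^ p) (deg-others _ (punchInᵢ≢i i₀ j))) ⟩
  d′ ^ p + ∑[ j < n ] (d ^ p)                   ≡⟨ cong (d′ ^ p +_) (∑-const n (d ^ p)) ⟩
  d′ ^ p + n * d ^ p                            ≡⟨ +-comm (d′ ^ p) _ ⟩
  n * d ^ p + d′ ^ p                            ∎
  where open ≡-Reasoning

e-≤-except : ∀ {n d d′} p (G : Graph n) i₀ → degree G i₀ ≤ d′ → (∀ i → degree G i ≤ d) →
             e p G ≤ (n ∸ 1) * d ^ p + d′ ^ p
e-≤-except p G i₀ deg-i₀ Δ≤d =
  subst (_≤ _) (sym (e≡∑ p G)) (∑-≤-except _ i₀ (^-monoˡ-≤ p deg-i₀) (λ i → ^-monoˡ-≤ p (Δ≤d i)))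

degree≤-except : ∀ {n d} (G : Graph n) i₀ → degree G i₀ ≡ d ∸ 1 → (∀ i → i ≢ i₀ → degree G i ≡ d) →
                 ∀ i → degree G i ≤ d
degree≤-except {d = d} G i₀ deg-i₀ deg-others i with i ≟ᶠ i₀
... | yes refl  = subst (_≤ d) (sym deg-i₀) (m∸n≤m d 1)
... | no  i≢i₀ = ≤-reflexive (deg-others i i≢i₀)

deficient-vertex : ∀ {n d} (G : Graph n) → (∀ i → degree G i ≤ d) → ¬ 2 ∣ n * d →
                   ∃ λ i → degree G i ≤ d ∸ 1
deficient-vertex {n} {d} G Δ≤d 2∤nd =
  let (i , deg≢d) = ¬∀⟶∃¬ n _ (λ i → degree G i ≟ d) not-regular in
  i , ∸-monoˡ-≤ 1 (≤∧≢⇒< (Δ≤d i) deg≢d)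
  where
  not-regular : ¬ (∀ i → degree G i ≡ d)
  not-regular reg = 2∤nd (subst (2 ∣_) (trans (sum-cong-≗ reg) (∑-const n d)) (handshake-degrees G))

-- Circulant graphs

sumUpTo : ℕ → (ℕ → ℕ) → ℕ
sumUpTo n f = ∑[ i < n ] f (toℕ i)

sumUpTo-cong : ∀ n {f g : ℕ → ℕ} → (∀ t → t < n → f t ≡ g t) → sumUpTo n f ≡ sumUpTo n g
sumUpTo-cong n f≡g = sum-cong-≗ (λ i → f≡g (toℕ i) (toℕ<n i))

sumUpTo-distrib : ∀ n (f g : ℕ → ℕ) → sumUpTo n (λ t → f t + g t) ≡ sumUpTo n f + sumUpTo n g
sumUpTo-distrib n f g = ∑-distrib-+ {n} (f ∘ toℕ) (g ∘ toℕ)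

sumUpTo-+ : ∀ m n (f : ℕ → ℕ) → sumUpTo (m + n) f ≡ sumUpTo m f + sumUpTo n (λ t → f (m + t))
sumUpTo-+ zero    n f = refl
sumUpTo-+ (suc m) n f = trans (cong (f 0 +_) (sumUpTo-+ m n (f ∘ suc))) (sym (+-assoc (f 0) _ _))

sumUpTo-last : ∀ n (f : ℕ → ℕ) → sumUpTo (suc n) f ≡ sumUpTo n f + f n
sumUpTo-last zero    f = +-comm (f 0) 0
sumUpTo-last (suc n) f = trans (cong (f 0 +_) (sumUpTo-last n (f ∘ suc))) (sym (+-assoc (f 0) _ _))

sumUpTo-reverse : ∀ n (f : ℕ → ℕ) → sumUpTo n (λ t → f (n ∸ t)) ≡ sumUpTo n (f ∘ suc)
sumUpTo-reverse zero    f = refl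
sumUpTo-reverse (suc n) f = begin
  f (suc n) + sumUpTo n (λ t → f (n ∸ t))  ≡⟨ cong (f (suc n) +_) (sumUpTo-reverse n f) ⟩
  f (suc n) + sumUpTo n (f ∘ suc)          ≡⟨ +-comm (f (suc n)) _ ⟩
  sumUpTo n (f ∘ suc) + f (suc n)          ≡⟨ sumUpTo-last n (f ∘ suc) ⟨
  sumUpTo (suc n) (f ∘ suc)                ∎
  where open ≡-Reasoning

sumUpTo-restrict : ∀ {m n} (b : ℕ → Bool) → m ≤ n →
                   sumUpTo n (λ y → ⟦ (y <ᵇ m) ∧ b y ⟧) ≡ sumUpTo m (λ y → ⟦ b y ⟧)
sumUpTo-restrict {zero}  {n}     b _         = sum-replicate-zero n
sumUpTo-restrict {suc m} {suc n} b (s≤s m≤n) = cong (⟦ b 0 ⟧ +_) (sumUpTo-restrict (b ∘ suc) m≤n)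

distance : (ℕ → Bool) → ℕ → ℕ → Bool
distance D x y = (0 <ᵇ ∣ x - y ∣) ∧ D ∣ x - y ∣

distance-sym : ∀ D x y → distance D x y ≡ distance D y x
distance-sym D x y rewrite ∣-∣-comm x y = refl

distance-irrefl : ∀ D x → distance D x x ≡ false
distance-irrefl D x rewrite ∣n-n∣≡0 x = refl

T-distance : ∀ D x y → T (distance D x y) → 0 < ∣ x - y ∣ × T (D ∣ x - y ∣)
T-distance D x y t = let (t₁ , t₂) = Equivalence.to T-∧ t in <ᵇ⇒< 0 _ t₁ , t₂

countDistances : (ℕ → Bool) → ℕ → ℕ
countDistances D a = sumUpTo a (λ t → ⟦ D (suc t) ⟧)

distance-degree : ∀ D x a →
  sumUpTo (x + suc a) (λ y → ⟦ distance D x y ⟧) ≡ countDistances D x + countDistances D a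
distance-degree D x a = begin
  sumUpTo (x + suc a) (λ y → ι ∣ x - y ∣)
    ≡⟨ sumUpTo-+ x (suc a) (λ y → ι ∣ x - y ∣) ⟩
  sumUpTo x (λ y → ι ∣ x - y ∣) + sumUpTo (suc a) (λ t → ι ∣ x - x + t ∣)
    ≡⟨ cong₂ _+_ (sumUpTo-cong x λ y y<x → cong ι (m≤n⇒∣n-m∣≡n∸m (<⇒≤ y<x)))
                 (sumUpTo-cong (suc a) λ t _ → cong ι (∣m-m+n∣≡n x t)) ⟩
  sumUpTo x (λ y → ι (x ∸ y)) + sumUpTo (suc a) ι
    ≡⟨ cong (_+ sumUpTo (suc a) ι) (sumUpTo-reverse x ι) ⟩
  countDistances D x + countDistances D a ∎
  where
  open ≡-Reasoning
  ι : ℕ → ℕ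
  ι δ = ⟦ (0 <ᵇ δ) ∧ D δ ⟧

countDistances-≤ᵇ : ∀ r a → countDistances (_≤ᵇ r) a ≡ a ⊓ r
countDistances-≤ᵇ r       zero    = refl
countDistances-≤ᵇ zero    (suc a) = sum-replicate-zero a
countDistances-≤ᵇ (suc r) (suc a) = cong suc (countDistances-≤ᵇ r a)

countDistances-≥ : ∀ c a → countDistances (suc c ≤ᵇ_) a ≡ a ∸ c
countDistances-≥ c       zero    = sym (0∸n≡0 c)
countDistances-≥ zero    (suc a) = cong suc (countDistances-≥ zero a)
countDistances-≥ (suc c) (suc a) = countDistances-≥ c a

countDistances-far : ∀ {n} x x′ r → x + suc x′ ≡ n → r ≤ x + x′ → countDistances ((n ∸ r) ≤ᵇ_) x ≡ r ∸ x′
countDistances-far x x′ r refl r≤x+x′ = begin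
  countDistances ((x + suc x′ ∸ r) ≤ᵇ_) x    ≡⟨ cong (λ c → countDistances (c ≤ᵇ_) x) threshold ⟩
  countDistances (suc (x + x′ ∸ r) ≤ᵇ_) x    ≡⟨ countDistances-≥ (x + x′ ∸ r) x ⟩
  x ∸ (x + x′ ∸ r)                           ≡⟨ m∸[m+n∸o]≡o∸n x x′ r r≤x+x′ ⟩
  r ∸ x′                                     ∎
  where
  open ≡-Reasoning
  threshold : x + suc x′ ∸ r ≡ suc (x + x′ ∸ r)
  threshold = trans (cong (_∸ r) (+-suc x x′)) (+-∸-assoc 1 r≤x+x′)

countDistances-≡ᵇ : ∀ c a → countDistances (_≡ᵇ suc c) a ≡ ⟦ c <ᵇ a ⟧
countDistances-≡ᵇ c       zero    = refl
countDistances-≡ᵇ zero    (suc a) = cong suc (sum-replicate-zero a)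
countDistances-≡ᵇ (suc c) (suc a) = countDistances-≡ᵇ c a

matching : ℕ → ℕ → ℕ → Bool
matching h x y = (x <ᵇ h + h) ∧ (y <ᵇ h + h) ∧ distance (_≡ᵇ h) x y

matching-sym : ∀ h x y → matching h x y ≡ matching h y x
matching-sym h x y with x <ᵇ h + h | y <ᵇ h + h
... | true  | true  = distance-sym (_≡ᵇ h) x y
... | true  | false = refl
... | false | true  = refl
... | false | false = refl

matching-irrefl : ∀ h x → matching h x x ≡ false
matching-irrefl h x with x <ᵇ h + h
... | true  = distance-irrefl (_≡ᵇ h) x
... | false = refl

T-matching : ∀ {h x y} → T (matching h x y) → 0 < h × ∣ x - y ∣ ≡ h
T-matching {h} {x} {y} t with Equivalence.to (T-∧ {x <ᵇ h + h}) t
... | _ , t′ with Equivalence.to (T-∧ {y <ᵇ h + h}) t′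
... | _ , t″ with T-distance (_≡ᵇ h) x y t″
... | 0<δ , δ≡ᵇh = subst (0 <_) δ≡h 0<δ , δ≡h
  where δ≡h = ≡ᵇ⇒≡ _ h δ≡ᵇh

-- The partner of x < 2h is x + h or x ∸ h, according as x < h or not.
⟦h≤x⟧+⟦h≤2h∸1+x⟧≡1 : ∀ {h x} → x < h + h → ⟦ h ≤ᵇ x ⟧ + ⟦ h ≤ᵇ h + h ∸ suc x ⟧ ≡ 1
⟦h≤x⟧+⟦h≤2h∸1+x⟧≡1 {h} {x} x<2h with x <? h
... | yes x<h = cong₂ _+_ (⟦⟧-false λ h≤x → <⇒≱ x<h (≤ᵇ⇒≤ h x h≤x))
                          (⟦⟧-true (≤⇒≤ᵇ (m+n≤o⇒m≤o∸n h (+-monoʳ-≤ h x<h))))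
... | no  x≮h = cong₂ _+_ (⟦⟧-true (≤⇒≤ᵇ (≮⇒≥ x≮h)))
                          (⟦⟧-false λ h≤ → x≮h (+-cancelˡ-≤ h _ _ (m≤o∸n⇒m+n≤o h x<2h (≤ᵇ⇒≤ h _ h≤))))

matching-degree : ∀ {n} h x → h + h ≤ n → sumUpTo n (λ y → ⟦ matching h x y ⟧) ≡ ⟦ x <ᵇ h + h ⟧
matching-degree {n} zero    x _ = sum-replicate-zero n
matching-degree {n} (suc c) x 2h≤n with x <ᵇ suc c + suc c in x<ᵇ2h
... | false = sum-replicate-zero n
... | true  = begin
  sumUpTo n (λ y → ⟦ (y <ᵇ h + h) ∧ distance D x y ⟧)
    ≡⟨ sumUpTo-restrict (distance D x) 2h≤n ⟩
  sumUpTo (h + h) (λ y → ⟦ distance D x y ⟧)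
    ≡⟨ cong (λ m → sumUpTo m (λ y → ⟦ distance D x y ⟧)) h+h≡ ⟨
  sumUpTo (x + suc a) (λ y → ⟦ distance D x y ⟧)
    ≡⟨ distance-degree D x a ⟩
  countDistances D x + countDistances D a
    ≡⟨ cong₂ _+_ (countDistances-≡ᵇ c x) (countDistances-≡ᵇ c a) ⟩
  ⟦ h ≤ᵇ x ⟧ + ⟦ h ≤ᵇ a ⟧
    ≡⟨ ⟦h≤x⟧+⟦h≤2h∸1+x⟧≡1 {h} x<2h ⟩
  1 ∎
  where
  open ≡-Reasoning
  h = suc c
  D = _≡ᵇ h
  a = h + h ∸ suc x
  x<2h : x < h + h
  x<2h = <ᵇ⇒< x (h + h) (subst T (sym x<ᵇ2h) _)
  h+h≡ : x + suc a ≡ h + h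
  h+h≡ = trans (+-suc x a) (m+[n∸m]≡n x<2h)

-- On ℤ/n, near and far neighbours together are those at cyclic distance at most r.
circulant : ℕ → ℕ → ℕ → ℕ → ℕ → Bool
circulant n r h x y = distance (_≤ᵇ r) x y ∨ distance ((n ∸ r) ≤ᵇ_) x y ∨ matching h x y

circulant-sym : ∀ n r h x y → circulant n r h x y ≡ circulant n r h y x
circulant-sym n r h x y =
  cong₂ _∨_ (distance-sym (_≤ᵇ r) x y) (cong₂ _∨_ (distance-sym ((n ∸ r) ≤ᵇ_) x y) (matching-sym h x y))

circulant-irrefl : ∀ n r h x → circulant n r h x x ≡ false
circulant-irrefl n r h x =
  cong₂ _∨_ (distance-irrefl (_≤ᵇ r) x)
            (cong₂ _∨_ (distance-irrefl ((n ∸ r) ≤ᵇ_) x) (matching-irrefl h x))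

circulant-layers : ∀ {n r h} x y → r + r < n → h + h ≤ n → (0 < h → r < h) →
                   ⟦ circulant n r h x y ⟧ ≡
                   ⟦ distance (_≤ᵇ r) x y ⟧ + (⟦ distance ((n ∸ r) ≤ᵇ_) x y ⟧ + ⟦ matching h x y ⟧)
circulant-layers {n} {r} {h} x y 2r<n 2h≤n 0<h⇒r<h = trans
  (⟦∨⟧ _ _ λ t → [ near-far t , near-matching t ] ∘ Equivalence.to T-∨)
  (cong (⟦ distance (_≤ᵇ r) x y ⟧ +_) (⟦∨⟧ _ _ far-matching))
  where
  δ≤r : T (distance (_≤ᵇ r) x y) → ∣ x - y ∣ ≤ r
  δ≤r = ≤ᵇ⇒≤ _ _ ∘ proj₂ ∘ T-distance (_≤ᵇ r) x y
  n∸r≤δ : T (distance ((n ∸ r) ≤ᵇ_) x y) → n ∸ r ≤ ∣ x - y ∣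
  n∸r≤δ = ≤ᵇ⇒≤ _ _ ∘ proj₂ ∘ T-distance ((n ∸ r) ≤ᵇ_) x y
  h<n∸r : 0 < h → h < n ∸ r
  h<n∸r 0<h = m+n≤o⇒m≤o∸n (suc h) (≤-trans (+-monoʳ-< h (0<h⇒r<h 0<h)) 2h≤n)
  near-far : T (distance (_≤ᵇ r) x y) → T (distance ((n ∸ r) ≤ᵇ_) x y) → ⊥
  near-far t t′ = <⇒≱ (m+n≤o⇒m≤o∸n (suc r) 2r<n) (≤-trans (n∸r≤δ t′) (δ≤r t))
  near-matching : T (distance (_≤ᵇ r) x y) → T (matching h x y) → ⊥
  near-matching t t′ = let (0<h , δ≡h) = T-matching {h} t′ in
    <⇒≱ (0<h⇒r<h 0<h) (subst (_≤ r) δ≡h (δ≤r t))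
  far-matching : T (distance ((n ∸ r) ≤ᵇ_) x y) → T (matching h x y) → ⊥
  far-matching t t′ = let (0<h , δ≡h) = T-matching {h} t′ in
    <⇒≱ (h<n∸r 0<h) (subst (n ∸ r ≤_) δ≡h (n∸r≤δ t))

circulant-degreeℕ : ∀ {n r h} x x′ → x + suc x′ ≡ n → r + r < n → h + h ≤ n → (0 < h → r < h) →
                    sumUpTo n (λ y → ⟦ circulant n r h x y ⟧) ≡ r + r + ⟦ x <ᵇ h + h ⟧
circulant-degreeℕ {n} {r} {h} x x′ refl 2r<n 2h≤n 0<h⇒r<h = begin
  sumUpTo n (λ y → ⟦ circulant n r h x y ⟧)
    ≡⟨ sumUpTo-cong n (λ y _ → circulant-layers x y 2r<n 2h≤n 0<h⇒r<h) ⟩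
  sumUpTo n (λ y → ⟦ near y ⟧ + (⟦ far y ⟧ + ⟦ matching h x y ⟧))
    ≡⟨ sumUpTo-distrib n (⟦_⟧ ∘ near) (λ y → ⟦ far y ⟧ + ⟦ matching h x y ⟧) ⟩
  sumUpTo n (⟦_⟧ ∘ near) + sumUpTo n (λ y → ⟦ far y ⟧ + ⟦ matching h x y ⟧)
    ≡⟨ cong (sumUpTo n (⟦_⟧ ∘ near) +_) (sumUpTo-distrib n (⟦_⟧ ∘ far) (λ y → ⟦ matching h x y ⟧)) ⟩
  sumUpTo n (⟦_⟧ ∘ near) + (sumUpTo n (⟦_⟧ ∘ far) + sumUpTo n (λ y → ⟦ matching h x y ⟧))
    ≡⟨ cong₂ _+_ near-degree (cong₂ _+_ far-degree (matching-degree h x 2h≤n)) ⟩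
  (x ⊓ r + x′ ⊓ r) + ((r ∸ x′ + (r ∸ x)) + ⟦ x <ᵇ h + h ⟧)
    ≡⟨ +-regroup (x ⊓ r) (x′ ⊓ r) (r ∸ x′) (r ∸ x) _ ⟩
  (x ⊓ r + (r ∸ x)) + (x′ ⊓ r + (r ∸ x′)) + ⟦ x <ᵇ h + h ⟧
    ≡⟨ cong (_+ ⟦ x <ᵇ h + h ⟧) (cong₂ _+_ (m⊓n+n∸m≡n x r) (m⊓n+n∸m≡n x′ r)) ⟩
  r + r + ⟦ x <ᵇ h + h ⟧ ∎
  where
  open ≡-Reasoning
  near far : ℕ → Bool
  near = distance (_≤ᵇ r) x
  far  = distance ((n ∸ r) ≤ᵇ_) x
  r≤x+x′ : r ≤ x + x′
  r≤x+x′ = m+n≤o⇒n≤o r (s≤s⁻¹ (subst (r + r <_) (+-suc x x′) 2r<n))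
  x′+1+x≡n : x′ + suc x ≡ n
  x′+1+x≡n = trans (+-suc x′ x) (trans (cong suc (+-comm x′ x)) (sym (+-suc x x′)))
  near-degree : sumUpTo n (⟦_⟧ ∘ near) ≡ x ⊓ r + x′ ⊓ r
  near-degree = trans (distance-degree (_≤ᵇ r) x x′)
                      (cong₂ _+_ (countDistances-≤ᵇ r x) (countDistances-≤ᵇ r x′))
  far-degree : sumUpTo n (⟦_⟧ ∘ far) ≡ r ∸ x′ + (r ∸ x)
  far-degree = trans (distance-degree ((n ∸ r) ≤ᵇ_) x x′)
                     (cong₂ _+_ (countDistances-far x x′ r refl r≤x+x′)
                                (countDistances-far x′ x r x′+1+x≡n (subst (r ≤_) (+-comm x x′) r≤x+x′)))

circulantGraph : ∀ n → ℕ → ℕ → Graph n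
circulantGraph n r h = record
  { adj    = λ i j → circulant n r h (toℕ i) (toℕ j)
  ; sym    = λ i j → circulant-sym n r h (toℕ i) (toℕ j)
  ; irrefl = λ i → circulant-irrefl n r h (toℕ i)
  }

circulant-degree : ∀ {n r h} → r + r ≤ n ∸ 1 → h + h ≤ n → (0 < h → r < h) →
                   ∀ i → degree (circulantGraph n r h) i ≡ r + r + ⟦ toℕ i <ᵇ h + h ⟧
circulant-degree {suc n} {r} {h} 2r≤n 2h≤n 0<h⇒r<h i =
  trans (degree≡count (circulantGraph (suc n) r h) i)
        (circulant-degreeℕ (toℕ i) _ (trans (+-suc _ _) (m+[n∸m]≡n (toℕ<n i))) (s≤s 2r≤n) 2h≤n 0<h⇒r<h)

-- Extremal graphs

-- With truncated subtraction, d ≤ n ∸ 1 also admits the empty graph (n = d = 0).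
regular : ∀ {n d} → d ≤ n ∸ 1 → 2 ∣ n * d → Σ (Graph n) λ G → ∀ i → degree G i ≡ d
regular {n} {d} d≤n-1 2∣nd with even-or-odd d
... | even r = circulantGraph n r 0 , λ i →
  trans (circulant-degree {h = 0} d≤n-1 z≤n (λ ()) i) (+-identityʳ (r + r))
... | odd r with euclidsLemma n d prime[2] 2∣nd
...   | inj₂ 2∣d = ⊥-elim (¬2∣odd r 2∣d)
...   | inj₁ 2∣n with even-or-odd n
...     | odd h  = ⊥-elim (¬2∣odd h 2∣n)
...     | even h = circulantGraph (h + h) r h , λ i →
  trans (circulant-degree (≤-trans (n≤1+n _) d≤n-1) ≤-refl (λ _ → r<h) i)
        (trans (cong (r + r +_) (⟦⟧-true (<⇒<ᵇ (toℕ<n i)))) (+-comm (r + r) 1))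
  where
  r<h : r < h
  r<h = half-< (≤-trans d≤n-1 (m∸n≤m (h + h) 1))

nearRegular : ∀ {n d} → d < n → ¬ 2 ∣ n → ¬ 2 ∣ d →
              Σ (Graph n) λ G → Σ (Fin n) λ i₀ → degree G i₀ ≡ d ∸ 1 × (∀ i → i ≢ i₀ → degree G i ≡ d)
nearRegular {n} {d} d<n 2∤n 2∤d with even-or-odd n | even-or-odd d
... | even h | _      = ⊥-elim (2∤n (2∣m+m h))
... | odd h  | even r = ⊥-elim (2∤d (2∣m+m r))
... | odd h  | odd r  = G , fromℕ (h + h) , degree-last , degree-others
  where
  G : Graph (suc (h + h))
  G = circulantGraph (suc (h + h)) r h
  2r<2h : r + r < h + h
  2r<2h = s≤s⁻¹ d<n
  degree-formula : ∀ i → degree G i ≡ r + r + ⟦ toℕ i <ᵇ h + h ⟧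
  degree-formula = circulant-degree {r = r} {h} (≤-trans (n≤1+n _) 2r<2h) (n≤1+n _) (λ _ → half-< 2r<2h)
  degree-last : degree G (fromℕ (h + h)) ≡ r + r
  degree-last = begin
    degree G (fromℕ (h + h))                 ≡⟨ degree-formula (fromℕ (h + h)) ⟩
    r + r + ⟦ toℕ (fromℕ (h + h)) <ᵇ h + h ⟧ ≡⟨ cong (λ x → r + r + ⟦ x <ᵇ h + h ⟧) (toℕ-fromℕ (h + h)) ⟩
    r + r + ⟦ h + h <ᵇ h + h ⟧               ≡⟨ cong (r + r +_) (⟦⟧-false (<-irrefl refl ∘ <ᵇ⇒< (h + h) (h + h))) ⟩
    r + r + 0                                ≡⟨ +-identityʳ (r + r) ⟩
    r + r                                    ∎
    where open ≡-Reasoning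
  degree-others : ∀ i → i ≢ fromℕ (h + h) → degree G i ≡ suc (r + r)
  degree-others i i≢last =
    trans (degree-formula i) (trans (cong (r + r +_) (⟦⟧-true (<⇒<ᵇ i<2h))) (+-comm (r + r) 1))
    where
    i<2h : toℕ i < h + h
    i<2h = ≤∧≢⇒< (s≤s⁻¹ (toℕ<n i)) λ eq → i≢last (toℕ-injective (trans eq (sym (toℕ-fromℕ (h + h)))))

extremal : ∀ {n d} p t (G : Graph n) → (∀ i → degree G i ≤ d) → e p G ≡ t →
           (∀ (H : Graph n) → (∀ i → degree H i ≤ d) → e p H ≤ t) → IsTp p n (Star (suc (suc d))) t
extremal p t G Δ≤d eG≡t bound =
  (G , degree≤⇒starFree G Δ≤d , eG≡t) , λ H free → bound H (starFree⇒degree≤ H free)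

proposition4p2 : (k p : ℕ) → 2 ≤ k → 1 ≤ p →
    (∀ n → n ≤ k ∸ 2 → IsTp p n (Star k) (n * (n ∸ 1) ^ p))
    × (∀ n → n > k ∸ 2 → 2 ∣ n * k → IsTp p n (Star k) (n * (k ∸ 2) ^ p))
    × (∀ n → n > k ∸ 2 → ¬ (2 ∣ n * k) →
         IsTp p n (Star k) ((n ∸ 1) * (k ∸ 2) ^ p + (k ∸ 3) ^ p))
proposition4p2 (suc (suc d)) p (s≤s (s≤s z≤n)) _ = complete , regular-case , odd-case
  where
  complete : ∀ n → n ≤ d → IsTp p n (Star (suc (suc d))) (n * (n ∸ 1) ^ p)
  complete n n≤d =
    let (G , reg) = regular ≤-refl (2∣n*[n∸1] n) in
    extremal p _ G (λ i → ≤-trans (≤-reflexive (reg i)) (≤-trans (m∸n≤m n 1) n≤d)) (e-regular p G reg)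
      λ H _ → e-≤ p H (degree≤n∸1 H)
  regular-case : ∀ n → n > d → 2 ∣ n * suc (suc d) → IsTp p n (Star (suc (suc d))) (n * d ^ p)
  regular-case n d<n 2∣nk =
    let (G , reg) = regular (∸-monoˡ-≤ 1 d<n) (2∣n*[2+d]⇒2∣n*d n d 2∣nk) in
    extremal p _ G (≤-reflexive ∘ reg) (e-regular p G reg) (e-≤ p)
  odd-case : ∀ n → n > d → ¬ 2 ∣ n * suc (suc d) →
             IsTp p n (Star (suc (suc d))) ((n ∸ 1) * d ^ p + (d ∸ 1) ^ p)
  odd-case n d<n 2∤nk =
    let (G , i₀ , deg-i₀ , deg-others) =
          nearRegular d<n (2∤nk ∘ ∣m⇒∣m*n _) (2∤nk ∘ ∣n⇒∣m*n n ∘ ∣m∣n⇒∣m+n ∣-refl)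
    in extremal p _ G (degree≤-except G i₀ deg-i₀ deg-others) (e-except p G i₀ deg-i₀ deg-others)
         λ H Δ≤d → let (i , deg-i) = deficient-vertex H Δ≤d (2∤nk ∘ 2∣n*d⇒2∣n*[2+d] n d) in
                   e-≤-except p H i deg-i Δ≤d
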